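{- Let $n,s,t$ be positive integers with $n\geq t\geq s\geq 2$. Every edge-colored graph $G$ on $n$ vertices with $\sum_{v\in V(G)}d^c(v)>n^2/2+\sigma_{s,t}\,n^{2-1/s}+sn$ contains a properly colored $K_{s,t}$, where $\sigma_{s,t}=s\left(\frac{t-1}{(s-1)!}\right)^{1/s}$.
   Context: All graphs are finite and simple. An edge-colored graph is a graph with a color assigned to each edge (not necessarily proper). $d^c(v)$ is the number of distinct colors on edges incident to $v$. A subgraph is properly colored if any two adjacent edges of it receive different colors. -}

module Defs where

open import Data.Nat using (ℕ; _+_; _*_; _∸_; _^_; _<_; _!)
open import Data.Nat.Properties using (_≟_)
open import Data.Fin using (Fin)
open import Data.List using (List; length; mapMaybe; deduplicate; allFin; map)
open import Data.Nat.ListAction using (sum)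
open import Data.Maybe using (Maybe; nothing; just)
open import Data.Product using (_×_; Σ)
open import Relation.Binary.PropositionalEquality using (_≡_; _≢_)
open import Function.Definitions using (Injective)

-- An edge-colored (finite simple) graph on vertex set Fin n:
-- col u v = nothing  means u,v non-adjacent; col u v = just k means uv is an
-- edge with color k.
record EdgeColoredGraph (n : ℕ) : Set where
  field
    col   : Fin n → Fin n → Maybe ℕ
    loopless : ∀ v → col v v ≡ nothing
    symm  : ∀ u v → col u v ≡ col v u
open EdgeColoredGraph public

colorsAt : ∀ {n} → EdgeColoredGraph n → Fin n → List ℕ
colorsAt {n} G v = mapMaybe (col G v) (allFin n)

dc : ∀ {n} → EdgeColoredGraph n → Fin n → ℕ
dc G v = length (deduplicate _≟_ (colorsAt G v))

colorDegreeSum : ∀ {n} → EdgeColoredGraph n → ℕ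
colorDegreeSum {n} G = sum (map (dc G) (allFin n))

record ProperKst {n : ℕ} (G : EdgeColoredGraph n) (s t : ℕ) : Set where
  field
    f : Fin s → Fin n
    g : Fin t → Fin n
    f-inj : Injective _≡_ _≡_ f
    g-inj : Injective _≡_ _≡_ g
    disjoint : ∀ i j → f i ≢ g j
    isEdge : ∀ i j → col G (f i) (g j) ≢ nothing
    properAtF : ∀ i j j′ → j ≢ j′ → col G (f i) (g j) ≢ col G (f i) (g j′)
    properAtG : ∀ i i′ j → i ≢ i′ → col G (f i) (g j) ≢ col G (f i′) (g j)

-- The real-valued condition
--   S > n²/2 + σ_{s,t} n^{2-1/s} + s n,  σ_{s,t} = s ((t-1)/(s-1)!)^{1/s},
-- stated exactly in ℕ (for s ≥ 1): with A = 2S - n² - 2sn it is equivalent to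
--   A > 0  and  (s-1)! · A^s > 2^s · s^s · (t-1) · n^(2s-1).
Threshold : (n s t S : ℕ) → Set
Threshold n s t S =
  (n * n + 2 * s * n < 2 * S) ×
  (2 ^ s * s ^ s * (t ∸ 1) * n ^ (2 * s ∸ 1)
     < (s ∸ 1) ! * (2 * S ∸ (n * n + 2 * s * n)) ^ s)

{-# OPTIONS --safe #-}
-- At a vertex v, let the neighbour u represent the colour of vu if it is the last
-- neighbour of v (in vertex order) joined to v in that colour; so d^c(v) is at most the
-- number of representatives at v.  Let H join v and u when each represents the other.
-- H is properly coloured, since two H-edges at v of one colour would both be the last
-- edge of that colour at v, and an ordered pair (v, u) is counted at most
-- 1 + [vu ∈ H] times among representatives, so 2 Σ d^c(v) ≤ n² + Σ d_H(v).
-- The Kővári–Sós–Turán count then finds a K_{s,t} in H: if every s-set had fewer than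
-- t common neighbours, Σ_v C(d_H(v), s) ≤ (t-1) C(n, s), and the power-mean inequality
-- together with (d-s+1)^s ≤ s! C(d, s) and s! C(n, s) ≤ n^s would give
-- (2 Σ d^c(v) - n² - 2sn)^s ≤ (t-1) n^(2s-1), which the threshold excludes because
-- (s-1)! ≤ 2^s s^s.

module Submission where

open import Defs
open import Data.Nat using (ℕ; zero; suc; pred; _+_; _*_; _∸_; _^_; _≤_; _<_; z≤n; s≤s; _!)
open import Data.Nat.Properties
open import Data.Nat.Combinatorics using (_C_; nCk+nC[k+1]≡[n+1]C[k+1]; nC1≡n)
open import Data.Nat.ListAction using (sum)
open import Data.Nat.Tactic.RingSolver using (solve-∀)
open import Data.Fin as Fin using (Fin; zero; suc; inject≤)
import Data.Fin.Properties as Finₚ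
open import Data.Maybe using (Maybe; just; nothing)
open import Data.Maybe.Properties using () renaming (≡-dec to ≡-dec-Maybe)
import Data.Maybe.Relation.Unary.Any as Maybe
open import Data.List
  using (List; []; _∷_; map; length; filter; lookup; allFin; mapMaybe; catMaybes; deduplicate)
open import Data.List.Properties using (map-tabulate; length-tabulate; length-filter; filter-notAll)
open import Data.List.Membership.Propositional using (_∈_)
open import Data.List.Membership.Propositional.Properties using (∈-allFin; ∈-deduplicate⁺; ∈-lookup)
import Data.List.Membership.DecPropositional as DecMembership
import Data.List.Relation.Unary.Any as Any
open import Data.List.Relation.Unary.Any.Properties using (mapMaybe⁺; gmap)
open import Data.List.Relation.Unary.All as All using (All; []; _∷_)
open import Data.List.Relation.Unary.All.Properties using (all-filter)
open import Data.List.Relation.Unary.AllPairs using ([]; _∷_)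
open import Data.List.Relation.Unary.Unique.Propositional using (Unique)
open import Data.List.Relation.Unary.Unique.Propositional.Properties using (allFin⁺)
open import Data.List.Relation.Binary.Sublist.Propositional
  using (_⊆_; []; _∷ʳ_; _∷_; minimum; ⊆-refl; ⊆-trans)
open import Data.List.Relation.Binary.Sublist.Propositional.Properties using (filter-⊆; All-resp-⊆)
open import Data.Product using (_×_; _,_; proj₁; proj₂)
open import Data.Sum using (_⊎_; inj₁; inj₂)
open import Function using (id; _∘_)
open import Function.Definitions using (Injective)
open import Relation.Binary.Definitions using (DecidableEquality; tri<; tri≈; tri>)
  renaming (Decidable to Decidable₂)
open import Relation.Binary.PropositionalEquality
open import Relation.Unary using (Pred; Decidable)
open import Relation.Nullary using (¬_; Dec; yes; no; ¬?; _×-dec_; _→-dec_; contradiction)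
open import Algebra.Properties.CommutativeSemigroup +-commutativeSemigroup
  using () renaming (interchange to +-interchange; x∙yz≈y∙xz to x+[y+z]≡y+[x+z])
open import Algebra.Properties.CommutativeSemigroup *-commutativeSemigroup
  using () renaming (x∙yz≈y∙xz to x*[y*z]≡y*[x*z])

private variable A B : Set

∑-syntax : List A → (A → ℕ) → ℕ
∑-syntax xs f = sum (map f xs)

-- ∑[ x ∈ xs ] binds tighter than arithmetic: ∑[ x ∈ xs ] f x * c means (∑[ x ∈ xs ] f x) * c.
syntax ∑-syntax xs (λ x → e) = ∑[ x ∈ xs ] e

∑-cong : ∀ (xs : List A) {f g : A → ℕ} → (∀ x → f x ≡ g x) →
         ∑[ x ∈ xs ] f x ≡ ∑[ x ∈ xs ] g x
∑-cong []       f≗g = refl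
∑-cong (x ∷ xs) f≗g = cong₂ _+_ (f≗g x) (∑-cong xs f≗g)

∑-mono-≤ : ∀ (xs : List A) {f g : A → ℕ} → (∀ x → f x ≤ g x) →
           ∑[ x ∈ xs ] f x ≤ ∑[ x ∈ xs ] g x
∑-mono-≤ []       f≤g = z≤n
∑-mono-≤ (x ∷ xs) f≤g = +-mono-≤ (f≤g x) (∑-mono-≤ xs f≤g)

∑-distrib-+ : ∀ (xs : List A) (f g : A → ℕ) →
              ∑[ x ∈ xs ] (f x + g x) ≡ ∑[ x ∈ xs ] f x + ∑[ x ∈ xs ] g x
∑-distrib-+ []       f g = refl
∑-distrib-+ (x ∷ xs) f g = trans (cong (f x + g x +_) (∑-distrib-+ xs f g)) (+-interchange (f x) (g x) _ _)

∑-const : ∀ (xs : List A) c → ∑[ x ∈ xs ] c ≡ length xs * c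
∑-const []       c = refl
∑-const (x ∷ xs) c = cong (c +_) (∑-const xs c)

*-distribˡ-∑ : ∀ c (xs : List A) (f : A → ℕ) → c * ∑[ x ∈ xs ] f x ≡ ∑[ x ∈ xs ] (c * f x)
*-distribˡ-∑ c []       f = *-zeroʳ c
*-distribˡ-∑ c (x ∷ xs) f = trans (*-distribˡ-+ c (f x) _) (cong (c * f x +_) (*-distribˡ-∑ c xs f))

∑-*-∑ : ∀ (xs : List A) (ys : List B) (f : A → ℕ) (g : B → ℕ) →
        ∑[ x ∈ xs ] f x * ∑[ y ∈ ys ] g y ≡ ∑[ x ∈ xs ] ∑[ y ∈ ys ] (f x * g y)
∑-*-∑ []       ys f g = refl
∑-*-∑ (x ∷ xs) ys f g = trans (*-distribʳ-+ (∑[ y ∈ ys ] g y) (f x) _)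
  (cong₂ _+_ (*-distribˡ-∑ (f x) ys g) (∑-*-∑ xs ys f g))

∑-comm : ∀ (xs : List A) (ys : List B) (f : A → B → ℕ) →
         ∑[ x ∈ xs ] ∑[ y ∈ ys ] f x y ≡ ∑[ y ∈ ys ] ∑[ x ∈ xs ] f x y
∑-comm []       ys f = sym (trans (∑-const ys 0) (*-zeroʳ (length ys)))
∑-comm (x ∷ xs) ys f = trans (cong (∑[ y ∈ ys ] f x y +_) (∑-comm xs ys f))
  (sym (∑-distrib-+ ys (f x) (λ y → ∑[ x ∈ xs ] f x y)))

𝟙 : {P : Set} → Dec P → ℕ
𝟙 (yes _) = 1
𝟙 (no _)  = 0

count : {P : Pred A _} → Decidable P → List A → ℕ
count P? xs = ∑[ x ∈ xs ] 𝟙 (P? x)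

𝟙-cong : {P Q : Set} (p : Dec P) (q : Dec Q) → (P → Q) → (Q → P) → 𝟙 p ≡ 𝟙 q
𝟙-cong (yes _) (yes _) _   _   = refl
𝟙-cong (yes p) (no ¬q) P→Q _   = contradiction (P→Q p) ¬q
𝟙-cong (no ¬p) (yes q) _   Q→P = contradiction (Q→P q) ¬p
𝟙-cong (no _)  (no _)  _   _   = refl

𝟙+𝟙≤1+𝟙-× : {P Q : Set} (p : Dec P) (q : Dec Q) → 𝟙 p + 𝟙 q ≤ 1 + 𝟙 (p ×-dec q)
𝟙+𝟙≤1+𝟙-× (yes _) (yes _) = ≤-refl
𝟙+𝟙≤1+𝟙-× (yes _) (no _)  = ≤-refl
𝟙+𝟙≤1+𝟙-× (no _)  (yes _) = ≤-refl
𝟙+𝟙≤1+𝟙-× (no _)  (no _)  = z≤n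

module _ {R : A → A → Set} (R? : Decidable₂ R) where

  mutual? : Decidable₂ (λ v u → R v u × R u v)
  mutual? v u = R? v u ×-dec R? u v

  2*∑count≤length²+∑count-mutual : ∀ xs →
    2 * ∑[ v ∈ xs ] count (R? v) xs ≤ length xs * length xs + ∑[ v ∈ xs ] count (mutual? v) xs
  2*∑count≤length²+∑count-mutual xs = begin
    2 * arcs
      ≡⟨ cong (arcs +_) (+-identityʳ arcs) ⟩
    arcs + arcs
      ≡⟨ cong (arcs +_) (∑-comm xs xs (λ v u → 𝟙 (R? v u))) ⟩
    arcs + ∑[ v ∈ xs ] ∑[ u ∈ xs ] 𝟙 (R? u v)
      ≡⟨ ∑-distrib-+ xs _ _ ⟨
    ∑[ v ∈ xs ] (∑[ u ∈ xs ] 𝟙 (R? v u) + ∑[ u ∈ xs ] 𝟙 (R? u v))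
      ≡⟨ ∑-cong xs (λ v → ∑-distrib-+ xs _ _) ⟨
    ∑[ v ∈ xs ] ∑[ u ∈ xs ] (𝟙 (R? v u) + 𝟙 (R? u v))
      ≤⟨ ∑-mono-≤ xs (λ v → ∑-mono-≤ xs (λ u → 𝟙+𝟙≤1+𝟙-× (R? v u) (R? u v))) ⟩
    ∑[ v ∈ xs ] ∑[ u ∈ xs ] (1 + 𝟙 (mutual? v u))
      ≡⟨ ∑-cong xs (λ v → ∑-distrib-+ xs _ _) ⟩
    ∑[ v ∈ xs ] (∑[ u ∈ xs ] 1 + count (mutual? v) xs)
      ≡⟨ ∑-distrib-+ xs _ _ ⟩
    ∑[ v ∈ xs ] ∑[ u ∈ xs ] 1 + mutualArcs
      ≡⟨ cong (_+ mutualArcs) ∑∑1≡|xs|² ⟩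
    length xs * length xs + mutualArcs ∎
    where
      open ≤-Reasoning
      arcs       = ∑[ v ∈ xs ] count (R? v) xs
      mutualArcs = ∑[ v ∈ xs ] count (mutual? v) xs
      ∑∑1≡|xs|² : ∑[ v ∈ xs ] ∑[ u ∈ xs ] 1 ≡ length xs * length xs
      ∑∑1≡|xs|² = trans (∑-cong xs (λ _ → trans (∑-const xs 1) (*-identityʳ _))) (∑-const xs _)

rearrangement-+ : ∀ a d k → a * (a + d) ^ k + (a + d) * a ^ k ≤ a * a ^ k + (a + d) * (a + d) ^ k
rearrangement-+ a d k = begin
  a * b^k + (a + d) * a^k       ≡⟨ cong (a * b^k +_) (*-distribʳ-+ a^k a d) ⟩
  a * b^k + (a * a^k + d * a^k) ≤⟨ +-monoʳ-≤ (a * b^k) (+-monoʳ-≤ (a * a^k) (*-monoʳ-≤ d a^k≤b^k)) ⟩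
  a * b^k + (a * a^k + d * b^k) ≡⟨ x+[y+z]≡y+[x+z] (a * b^k) (a * a^k) (d * b^k) ⟩
  a * a^k + (a * b^k + d * b^k) ≡⟨ cong (a * a^k +_) (*-distribʳ-+ b^k a d) ⟨
  a * a^k + (a + d) * b^k ∎
  where
    open ≤-Reasoning
    a^k = a ^ k
    b^k = (a + d) ^ k
    a^k≤b^k = ^-monoˡ-≤ k (m≤m+n a d)

rearrangement : ∀ a b k → a * b ^ k + b * a ^ k ≤ a * a ^ k + b * b ^ k
rearrangement a b k with ≤-total a b
... | inj₁ a≤b with d , refl ← m≤n⇒∃[o]m+o≡n a≤b = rearrangement-+ a d k
... | inj₂ b≤a with d , refl ← m≤n⇒∃[o]m+o≡n b≤a =
  subst₂ _≤_ (+-comm (b * (b + d) ^ k) _) (+-comm (b * b ^ k) _) (rearrangement-+ b d k)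

chebyshev : ∀ (xs : List A) (f : A → ℕ) k →
            ∑[ x ∈ xs ] f x * ∑[ x ∈ xs ] (f x ^ k) ≤ length xs * ∑[ x ∈ xs ] (f x ^ suc k)
chebyshev xs f k = *-cancelˡ-≤ 2 (begin
  2 * (X * Y)
    ≡⟨ cong (X * Y +_) (+-identityʳ (X * Y)) ⟩
  X * Y + X * Y
    ≡⟨ cong (X * Y +_) (*-comm X Y) ⟩
  X * Y + Y * X
    ≡⟨ cong₂ _+_ (∑-*-∑ xs xs f g) (∑-*-∑ xs xs g f) ⟩
  ∑[ x ∈ xs ] ∑[ y ∈ xs ] (f x * g y) + ∑[ x ∈ xs ] ∑[ y ∈ xs ] (g x * f y)
    ≡⟨ ∑-distrib-+ xs _ _ ⟨
  ∑[ x ∈ xs ] (∑[ y ∈ xs ] (f x * g y) + ∑[ y ∈ xs ] (g x * f y))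
    ≡⟨ ∑-cong xs (λ x → ∑-distrib-+ xs _ _) ⟨
  ∑[ x ∈ xs ] ∑[ y ∈ xs ] (f x * g y + g x * f y)
    ≤⟨ ∑-mono-≤ xs (λ x → ∑-mono-≤ xs (λ y → pairwise x y)) ⟩
  ∑[ x ∈ xs ] ∑[ y ∈ xs ] (f x * g x + f y * g y)
    ≡⟨ ∑-cong xs (λ x → ∑-distrib-+ xs _ _) ⟩
  ∑[ x ∈ xs ] (∑[ y ∈ xs ] (f x * g x) + Q)
    ≡⟨ ∑-distrib-+ xs _ _ ⟩
  ∑[ x ∈ xs ] ∑[ y ∈ xs ] (f x * g x) + ∑[ x ∈ xs ] Q
    ≡⟨ cong₂ _+_ (∑-cong xs (λ x → ∑-const xs _)) (∑-const xs Q) ⟩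
  ∑[ x ∈ xs ] (n * (f x * g x)) + n * Q
    ≡⟨ cong (_+ n * Q) (*-distribˡ-∑ n xs _) ⟨
  n * Q + n * Q
    ≡⟨ cong (n * Q +_) (+-identityʳ (n * Q)) ⟨
  2 * (n * Q) ∎)
  where
    open ≤-Reasoning
    n = length xs
    g = λ x → f x ^ k
    X = ∑[ x ∈ xs ] f x
    Y = ∑[ x ∈ xs ] g x
    Q = ∑[ x ∈ xs ] (f x ^ suc k)
    pairwise : ∀ x y → f x * g y + g x * f y ≤ f x * g x + f y * g y
    pairwise x y = subst (λ z → f x * g y + z ≤ f x * g x + f y * g y)
                         (*-comm (f y) (g x)) (rearrangement (f x) (f y) k)

power-mean : ∀ (xs : List A) (f : A → ℕ) k →
             (∑[ x ∈ xs ] f x) ^ suc k ≤ length xs ^ k * ∑[ x ∈ xs ] (f x ^ suc k)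
power-mean xs f zero = ≤-reflexive (begin-equality
  X * 1                     ≡⟨ *-identityʳ X ⟩
  X                         ≡⟨ ∑-cong xs (λ x → *-identityʳ (f x)) ⟨
  ∑[ x ∈ xs ] (f x ^ 1)     ≡⟨ +-identityʳ _ ⟨
  1 * ∑[ x ∈ xs ] (f x ^ 1) ∎)
  where
    open ≤-Reasoning
    X = ∑[ x ∈ xs ] f x
power-mean xs f (suc k) = begin
  X * X ^ suc k                 ≤⟨ *-monoʳ-≤ X (power-mean xs f k) ⟩
  X * (n ^ k * Q)               ≡⟨ x*[y*z]≡y*[x*z] X (n ^ k) Q ⟩
  n ^ k * (X * Q)               ≤⟨ *-monoʳ-≤ (n ^ k) (chebyshev xs f (suc k)) ⟩
  n ^ k * (n * Q′)              ≡⟨ x*[y*z]≡y*[x*z] (n ^ k) n Q′ ⟩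
  n * (n ^ k * Q′)              ≡⟨ *-assoc n (n ^ k) Q′ ⟨
  n ^ suc k * Q′ ∎
  where
    open ≤-Reasoning
    n  = length xs
    X  = ∑[ x ∈ xs ] f x
    Q  = ∑[ x ∈ xs ] (f x ^ suc k)
    Q′ = ∑[ x ∈ xs ] (f x ^ suc (suc k))

n^[1+k]+[1+k]*n^k≤[1+n]^[1+k] : ∀ n k → n ^ suc k + suc k * n ^ k ≤ suc n ^ suc k
n^[1+k]+[1+k]*n^k≤[1+n]^[1+k] n zero = ≤-reflexive (expand n)
  where
    expand : ∀ n → n * 1 + 1 * 1 ≡ suc n * 1
    expand = solve-∀
n^[1+k]+[1+k]*n^k≤[1+n]^[1+k] n (suc k) = begin
  n * (n * n^k) + suc (suc k) * (n * n^k)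
    ≤⟨ m≤m+n _ (suc k * n^k) ⟩
  n * (n * n^k) + suc (suc k) * (n * n^k) + suc k * n^k ≡⟨ expand n k n^k ⟩
  suc n * (n * n^k + suc k * n^k)
    ≤⟨ *-monoʳ-≤ (suc n) (n^[1+k]+[1+k]*n^k≤[1+n]^[1+k] n k) ⟩
  suc n * suc n ^ suc k ∎
  where
    open ≤-Reasoning
    n^k = n ^ k
    expand : ∀ n k p → n * (n * p) + suc (suc k) * (n * p) + suc k * p ≡ suc n * (n * p + suc k * p)
    expand = solve-∀

n^[1+k]≤[n∸1]^[1+k]+[1+k]*n^k : ∀ n k → n ^ suc k ≤ pred n ^ suc k + suc k * n ^ k
n^[1+k]≤[n∸1]^[1+k]+[1+k]*n^k zero    k       = z≤n
n^[1+k]≤[n∸1]^[1+k]+[1+k]*n^k (suc n) zero    = ≤-reflexive (expand n)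
  where
    expand : ∀ n → suc n * 1 ≡ n * 1 + 1 * 1
    expand = solve-∀
n^[1+k]≤[n∸1]^[1+k]+[1+k]*n^k (suc n) (suc k) = begin
  suc n * suc n ^ suc k
    ≤⟨ *-monoʳ-≤ (suc n) (n^[1+k]≤[n∸1]^[1+k]+[1+k]*n^k (suc n) k) ⟩
  suc n * (n^[1+k] + suc k * m^k)
    ≡⟨ expand n k n^[1+k] m^k ⟩
  n * n^[1+k] + (n^[1+k] + suc k * (suc n * m^k)) ≤⟨ +-monoʳ-≤ (n * n^[1+k]) (+-monoˡ-≤ _ n^[1+k]≤m^[1+k]) ⟩
  n * n^[1+k] + suc (suc k) * (suc n * m^k) ∎
  where
    open ≤-Reasoning
    n^[1+k] = n ^ suc k
    m^k     = suc n ^ k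
    n^[1+k]≤m^[1+k] = ^-monoˡ-≤ (suc k) (n≤1+n n)
    expand : ∀ n k p q → suc n * (p + suc k * q) ≡ n * p + (p + suc k * (suc n * q))
    expand = solve-∀

k!*nCk≤n^k : ∀ n k → k ! * (n C k) ≤ n ^ k
k!*nCk≤n^k n       zero    = ≤-refl
k!*nCk≤n^k zero    (suc k) = ≤-reflexive (*-zeroʳ (suc k !))
k!*nCk≤n^k (suc n) (suc k) = begin
  suc k ! * (suc n C suc k)
    ≡⟨ cong (suc k ! *_) (nCk+nC[k+1]≡[n+1]C[k+1] n k) ⟨
  suc k ! * (n C k + n C suc k)
    ≡⟨ regroup (suc k) (k !) (n C k) (n C suc k) ⟩
  suc k ! * (n C suc k) + suc k * (k ! * (n C k))
    ≤⟨ +-mono-≤ (k!*nCk≤n^k n (suc k)) (*-monoʳ-≤ (suc k) (k!*nCk≤n^k n k)) ⟩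
  n ^ suc k + suc k * n ^ k
    ≤⟨ n^[1+k]+[1+k]*n^k≤[1+n]^[1+k] n k ⟩
  suc n ^ suc k ∎
  where
    open ≤-Reasoning
    regroup : ∀ m p a b → m * p * (a + b) ≡ m * p * b + m * (p * a)
    regroup = solve-∀

[n∸k]^[1+k]≤[1+k]!*nC[1+k] : ∀ n k → (n ∸ k) ^ suc k ≤ suc k ! * (n C suc k)
[n∸k]^[1+k]≤[1+k]!*nC[1+k] n       zero    = ≤-reflexive (begin-equality
  n * 1       ≡⟨ *-identityʳ n ⟩
  n           ≡⟨ nC1≡n n ⟨
  n C 1       ≡⟨ +-identityʳ (n C 1) ⟨
  1 * (n C 1) ∎)
  where open ≤-Reasoning
[n∸k]^[1+k]≤[1+k]!*nC[1+k] zero    (suc k) = z≤n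
[n∸k]^[1+k]≤[1+k]!*nC[1+k] (suc n) (suc k) = begin
  (n ∸ k) ^ suc (suc k)
    ≤⟨ n^[1+k]≤[n∸1]^[1+k]+[1+k]*n^k (n ∸ k) (suc k) ⟩
  pred (n ∸ k) ^ suc (suc k) + suc (suc k) * (n ∸ k) ^ suc k
    ≡⟨ cong (λ m → m ^ suc (suc k) + suc (suc k) * (n ∸ k) ^ suc k) (pred[m∸n]≡m∸[1+n] n k) ⟩
  (n ∸ suc k) ^ suc (suc k) + suc (suc k) * (n ∸ k) ^ suc k
    ≤⟨ +-mono-≤ ([n∸k]^[1+k]≤[1+k]!*nC[1+k] n (suc k))
                (*-monoʳ-≤ (suc (suc k)) ([n∸k]^[1+k]≤[1+k]!*nC[1+k] n k)) ⟩
  suc (suc k) ! * (n C suc (suc k)) + suc (suc k) * (suc k ! * (n C suc k))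
    ≡⟨ regroup (suc (suc k)) (suc k !) (n C suc k) (n C suc (suc k)) ⟨
  suc (suc k) ! * (n C suc k + n C suc (suc k))
    ≡⟨ cong (suc (suc k) ! *_) (nCk+nC[k+1]≡[n+1]C[k+1] n (suc k)) ⟩
  suc (suc k) ! * (suc n C suc (suc k)) ∎
  where
    open ≤-Reasoning
    regroup : ∀ m p a b → m * p * (a + b) ≡ m * p * b + m * (p * a)
    regroup = solve-∀

n!≤n^n : ∀ n → n ! ≤ n ^ n
n!≤n^n zero    = ≤-refl
n!≤n^n (suc n) = *-monoʳ-≤ (suc n) (≤-trans (n!≤n^n n) (^-monoˡ-≤ n (n≤1+n n)))

∑≤length*k+∑[∸k] : ∀ (V : List A) (d : A → ℕ) k →
                   ∑[ v ∈ V ] d v ≤ length V * k + ∑[ v ∈ V ] (d v ∸ k)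
∑≤length*k+∑[∸k] V d k = begin
  ∑[ v ∈ V ] d v                      ≤⟨ ∑-mono-≤ V (λ v → m≤n+m∸n (d v) k) ⟩
  ∑[ v ∈ V ] (k + (d v ∸ k))          ≡⟨ ∑-distrib-+ V _ _ ⟩
  ∑[ v ∈ V ] k + ∑[ v ∈ V ] (d v ∸ k) ≡⟨ cong (_+ ∑[ v ∈ V ] (d v ∸ k)) (∑-const V k) ⟩
  length V * k + ∑[ v ∈ V ] (d v ∸ k) ∎
  where open ≤-Reasoning

kovari-sos-turan : ∀ (V : List A) (d : A → ℕ) k m N →
  ∑[ v ∈ V ] (d v C suc k) ≤ m * (N C suc k) →
  (∑[ v ∈ V ] (d v ∸ k)) ^ suc k ≤ m * (length V ^ k * N ^ suc k)
kovari-sos-turan V d k m N fewStars = begin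
  (∑[ v ∈ V ] (d v ∸ k)) ^ s
    ≤⟨ power-mean V (λ v → d v ∸ k) k ⟩
  |V|^k * ∑[ v ∈ V ] ((d v ∸ k) ^ s)
    ≤⟨ *-monoʳ-≤ |V|^k (∑-mono-≤ V (λ v → [n∸k]^[1+k]≤[1+k]!*nC[1+k] (d v) k)) ⟩
  |V|^k * ∑[ v ∈ V ] (s ! * (d v C s))
    ≡⟨ cong (|V|^k *_) (*-distribˡ-∑ (s !) V _) ⟨
  |V|^k * (s ! * ∑[ v ∈ V ] (d v C s))
    ≤⟨ *-monoʳ-≤ |V|^k (*-monoʳ-≤ (s !) fewStars) ⟩
  |V|^k * (s ! * (m * (N C s)))
    ≡⟨ cong (|V|^k *_) (x*[y*z]≡y*[x*z] (s !) m _) ⟩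
  |V|^k * (m * (s ! * (N C s)))
    ≡⟨ x*[y*z]≡y*[x*z] |V|^k m _ ⟩
  m * (|V|^k * (s ! * (N C s)))
    ≤⟨ *-monoʳ-≤ m (*-monoʳ-≤ |V|^k (k!*nCk≤n^k N s)) ⟩
  m * (|V|^k * N ^ s) ∎
  where
    open ≤-Reasoning
    s = suc k
    |V|^k = length V ^ k

m+n<o+p⇒m<o⊎n<p : ∀ {m n o p} → m + n < o + p → m < o ⊎ n < p
m+n<o+p⇒m<o⊎n<p {m} {n} {o} {p} m+n<o+p with m <? o
... | yes m<o = inj₁ m<o
... | no  m≮o = inj₂ (+-cancelˡ-< o n p (≤-<-trans (+-monoˡ-≤ n (≮⇒≥ m≮o)) m+n<o+p))

module _ {A B : Set} {R : A → B → Set} (R? : Decidable₂ R) where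

  degree : List B → A → ℕ
  degree L a = count (R? a) L

  neighbours : B → List A → List A
  neighbours x = filter (λ a → R? a x)

  record Biclique (s t : ℕ) (V : List A) (L : List B) : Set where
    field
      core                 : List B
      commonNeighbours     : List A
      core⊆                : core ⊆ L
      commonNeighbours⊆    : commonNeighbours ⊆ V
      |core|≡s             : length core ≡ s
      t≤|commonNeighbours| : t ≤ length commonNeighbours
      complete             : All (λ a → All (R a) core) commonNeighbours

  stars-∷ : ∀ x L V s →
    ∑[ a ∈ V ] (degree (x ∷ L) a C suc s) ≡
    ∑[ a ∈ V ] (degree L a C suc s) + ∑[ a ∈ neighbours x V ] (degree L a C s)
  stars-∷ x L []      s = refl
  stars-∷ x L (a ∷ V) s with R? a x
  ... | yes _ = begin
    suc d C suc s + ∑[ a ∈ V ] (degree (x ∷ L) a C suc s)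
      ≡⟨ cong₂ _+_ (nCk+nC[k+1]≡[n+1]C[k+1] d s) (sym (stars-∷ x L V s)) ⟨
    (d C s + d C suc s) + (avoiding + through)
      ≡⟨ cong (_+ (avoiding + through)) (+-comm (d C s) _) ⟩
    (d C suc s + d C s) + (avoiding + through)
      ≡⟨ +-interchange (d C suc s) (d C s) avoiding through ⟩
    (d C suc s + avoiding) + (d C s + through) ∎
    where
      open ≡-Reasoning
      d        = degree L a
      avoiding = ∑[ a ∈ V ] (degree L a C suc s)
      through  = ∑[ a ∈ neighbours x V ] (degree L a C s)
  ... | no _ = trans (cong (degree L a C suc s +_) (stars-∷ x L V s))
                     (sym (+-assoc (degree L a C suc s) _ _))

  -- By Pascal's rule the s-stars with leaves in x ∷ L are those avoiding x plus those
  -- through x, whose centres are neighbours of x; one of the two families exceeds its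
  -- share of (t - 1) C(|L| + 1, s), and induction on L applies to it.
  biclique-from-stars : ∀ t s L V →
    (t ∸ 1) * (length L C s) < ∑[ a ∈ V ] (degree L a C s) → Biclique s t V L
  biclique-from-stars t zero L V manyStars = record
    { core = [] ; commonNeighbours = V ; core⊆ = minimum L ; commonNeighbours⊆ = ⊆-refl
    ; |core|≡s = refl ; t≤|commonNeighbours| = t≤|V| ; complete = All.tabulate (λ _ → []) }
    where
      t≤|V| : t ≤ length V
      t≤|V| = ≤-trans (m≤n+m∸n t 1)
                (subst₂ _<_ (*-identityʳ (t ∸ 1)) (trans (∑-const V 1) (*-identityʳ _)) manyStars)
  biclique-from-stars t (suc s) [] V manyStars =
    contradiction (subst (_ <_) (trans (∑-const V 0) (*-zeroʳ (length V))) manyStars) (λ ())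
  biclique-from-stars t (suc s) (x ∷ L) V manyStars
    with m+n<o+p⇒m<o⊎n<p (subst₂ _<_ share-∷ (stars-∷ x L V s) manyStars)
    where
      share-∷ : (t ∸ 1) * (suc (length L) C suc s) ≡
                (t ∸ 1) * (length L C suc s) + (t ∸ 1) * (length L C s)
      share-∷ = trans (cong ((t ∸ 1) *_) (sym (nCk+nC[k+1]≡[n+1]C[k+1] (length L) s)))
                      (trans (*-distribˡ-+ (t ∸ 1) (length L C s) _) (+-comm ((t ∸ 1) * (length L C s)) _))
  ... | inj₁ manyAvoiding = record
    { core = core ; commonNeighbours = commonNeighbours
    ; core⊆ = x ∷ʳ core⊆ ; commonNeighbours⊆ = commonNeighbours⊆
    ; |core|≡s = |core|≡s ; t≤|commonNeighbours| = t≤|commonNeighbours| ; complete = complete }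
    where open Biclique (biclique-from-stars t (suc s) L V manyAvoiding)
  ... | inj₂ manyThrough = record
    { core = x ∷ core ; commonNeighbours = commonNeighbours
    ; core⊆ = refl ∷ core⊆ ; commonNeighbours⊆ = ⊆-trans commonNeighbours⊆ (filter-⊆ (λ a → R? a x) V)
    ; |core|≡s = cong suc |core|≡s ; t≤|commonNeighbours| = t≤|commonNeighbours|
    ; complete = All.zipWith (λ (r , rs) → r ∷ rs)
                   (All-resp-⊆ commonNeighbours⊆ (all-filter (λ a → R? a x) V) , complete) }
    where open Biclique (biclique-from-stars t s L (neighbours x V) manyThrough)

Unique-resp-⊆ : ∀ {xs ys : List A} → xs ⊆ ys → Unique ys → Unique xs
Unique-resp-⊆ []             []         = []
Unique-resp-⊆ (y ∷ʳ xs⊆ys)   (_ ∷ u)    = Unique-resp-⊆ xs⊆ys u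
Unique-resp-⊆ (refl ∷ xs⊆ys) (y∉ys ∷ u) = All-resp-⊆ xs⊆ys y∉ys ∷ Unique-resp-⊆ xs⊆ys u

lookup-injective : ∀ {xs : List A} → Unique xs → Injective _≡_ _≡_ (lookup xs)
lookup-injective {xs = x ∷ xs} (x∉xs ∷ u) {zero}  {zero}  _  = refl
lookup-injective {xs = x ∷ xs} (x∉xs ∷ u) {zero}  {suc j} eq = contradiction eq (All.lookup x∉xs (∈-lookup j))
lookup-injective {xs = x ∷ xs} (x∉xs ∷ u) {suc i} {zero}  eq = contradiction (sym eq) (All.lookup x∉xs (∈-lookup i))
lookup-injective {xs = x ∷ xs} (x∉xs ∷ u) {suc i} {suc j} eq = cong suc (lookup-injective u eq)

embed : ∀ {k} (xs : List A) → k ≤ length xs → Fin k → A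
embed xs k≤|xs| i = lookup xs (inject≤ i k≤|xs|)

embed-injective : ∀ {k} {xs : List A} (k≤|xs| : k ≤ length xs) →
                  Unique xs → Injective _≡_ _≡_ (embed xs k≤|xs|)
embed-injective k≤|xs| u eq = Finₚ.inject≤-injective k≤|xs| k≤|xs| _ _ (lookup-injective u eq)

map-allFin-suc : ∀ {n} (g : Fin (suc n) → B) → map g (allFin (suc n)) ≡ g zero ∷ map (g ∘ suc) (allFin n)
map-allFin-suc g = cong (g zero ∷_) (trans (map-tabulate suc g) (sym (map-tabulate id (g ∘ suc))))

∈-mapMaybe⁺ : ∀ (f : B → Maybe A) {xs y c} → y ∈ xs → f y ≡ just c → c ∈ mapMaybe f xs
∈-mapMaybe⁺ f {xs} y∈xs fy≡c =
  mapMaybe⁺ f xs (gmap (λ { refl → subst (Maybe.Any (_ ≡_)) (sym fy≡c) (Maybe.just refl) }) y∈xs)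

LastOccurrence : ∀ {n} → (Fin n → Maybe A) → Fin n → Set
LastOccurrence f u = f u ≢ nothing × (∀ w → u Fin.< w → f w ≢ f u)

lastOccurrence-injective : ∀ {n} {f : Fin n → Maybe A} {u v} →
  LastOccurrence f u → LastOccurrence f v → f u ≡ f v → u ≡ v
lastOccurrence-injective {u = u} {v} (_ , laterThanU) (_ , laterThanV) fu≡fv with Finₚ.<-cmp u v
... | tri< u<v _ _ = contradiction (sym fu≡fv) (laterThanU v u<v)
... | tri≈ _ u≡v _ = u≡v
... | tri> _ _ v<u = contradiction fu≡fv (laterThanV u v<u)

module _ (_≟_ : DecidableEquality A) where

  open DecMembership _≟_ using (_∈?_)

  lastOccurrence? : ∀ {n} (f : Fin n → Maybe A) → Decidable (LastOccurrence f)
  lastOccurrence? f u = ¬? (f u ≟ₘ nothing) ×-dec Finₚ.all? (λ w → u Fin.<? w →-dec ¬? (f w ≟ₘ f u))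
    where _≟ₘ_ = ≡-dec-Maybe _≟_

  𝟙-lastOccurrence-suc : ∀ {n} (f : Fin (suc n) → Maybe A) u →
    𝟙 (lastOccurrence? f (suc u)) ≡ 𝟙 (lastOccurrence? (f ∘ suc) u)
  𝟙-lastOccurrence-suc f u = 𝟙-cong (lastOccurrence? f (suc u)) (lastOccurrence? (f ∘ suc) u)
    (λ (isJust , later) → isJust , λ w u<w → later (suc w) (s≤s u<w))
    (λ (isJust , later) → isJust , λ { (suc w) (s≤s u<w) → later w u<w })

  ¬lastOccurrence⇒repeated : ∀ {n} (f : Fin (suc n) → Maybe A) → ¬ LastOccurrence f zero →
    ∀ c → f zero ≡ just c → c ∈ mapMaybe (f ∘ suc) (allFin n)
  ¬lastOccurrence⇒repeated {n} f ¬last c f0≡c with c ∈? mapMaybe (f ∘ suc) (allFin n)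
  ... | yes c∈later = c∈later
  ... | no  c∉later = contradiction (just≢nothing ∘ trans (sym f0≡c) , unrepeated) ¬last
    where
      just≢nothing : just c ≢ nothing
      just≢nothing ()
      unrepeated : ∀ w → zero {n} Fin.< w → f w ≢ f zero
      unrepeated (suc w) _ fw≡f0 = c∉later (∈-mapMaybe⁺ (f ∘ suc) (∈-allFin w) (trans fw≡f0 f0≡c))

  length-deduplicate-∷ : ∀ x xs → length (deduplicate _≟_ (x ∷ xs)) ≤ suc (length (deduplicate _≟_ xs))
  length-deduplicate-∷ x xs = s≤s (length-filter _ (deduplicate _≟_ xs))

  length-deduplicate-∷-∈ : ∀ {x xs} → x ∈ xs →
    length (deduplicate _≟_ (x ∷ xs)) ≤ length (deduplicate _≟_ xs)
  length-deduplicate-∷-∈ {x} {xs} x∈xs =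
    filter-notAll _ (deduplicate _≟_ xs) (Any.map (λ x≡y x≢y → x≢y x≡y) (∈-deduplicate⁺ _≟_ x∈xs))

  length-deduplicate-catMaybes-∷ : ∀ y ys →
    length (deduplicate _≟_ (catMaybes (y ∷ ys))) ≤ suc (length (deduplicate _≟_ (catMaybes ys)))
  length-deduplicate-catMaybes-∷ nothing  ys = n≤1+n _
  length-deduplicate-catMaybes-∷ (just c) ys = length-deduplicate-∷ c (catMaybes ys)

  length-deduplicate-catMaybes-∷-∈ : ∀ y ys → (∀ c → y ≡ just c → c ∈ catMaybes ys) →
    length (deduplicate _≟_ (catMaybes (y ∷ ys))) ≤ length (deduplicate _≟_ (catMaybes ys))
  length-deduplicate-catMaybes-∷-∈ nothing  ys _        = ≤-refl
  length-deduplicate-catMaybes-∷-∈ (just c) ys repeated = length-deduplicate-∷-∈ (repeated c refl)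

  distinctValues≤lastOccurrences : ∀ {n} (f : Fin n → Maybe A) →
    length (deduplicate _≟_ (mapMaybe f (allFin n))) ≤ count (lastOccurrence? f) (allFin n)
  distinctValues≤lastOccurrences {zero}  f = z≤n
  distinctValues≤lastOccurrences {suc n} f = begin
    length (deduplicate _≟_ (catMaybes (map f (allFin (suc n)))))
      ≡⟨ cong (λ ys → length (deduplicate _≟_ (catMaybes ys))) (map-allFin-suc f) ⟩
    length (deduplicate _≟_ (catMaybes (f zero ∷ later)))
      ≤⟨ first (lastOccurrence? f zero) ⟩
    𝟙 (lastOccurrence? f zero) + count (lastOccurrence? (f ∘ suc)) (allFin n)
      ≡⟨ cong (𝟙 (lastOccurrence? f zero) +_) (∑-cong (allFin n) (λ u → sym (𝟙-lastOccurrence-suc f u))) ⟩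
    𝟙 (lastOccurrence? f zero) + ∑[ u ∈ allFin n ] 𝟙 (lastOccurrence? f (suc u))
      ≡⟨ cong sum (map-allFin-suc (λ u → 𝟙 (lastOccurrence? f u))) ⟨
    count (lastOccurrence? f) (allFin (suc n)) ∎
    where
      open ≤-Reasoning
      later = map (f ∘ suc) (allFin n)
      rest  = distinctValues≤lastOccurrences (f ∘ suc)
      first : (last? : Dec (LastOccurrence f zero)) →
        length (deduplicate _≟_ (catMaybes (f zero ∷ later))) ≤
        𝟙 last? + count (lastOccurrence? (f ∘ suc)) (allFin n)
      first (yes _)    = ≤-trans (length-deduplicate-catMaybes-∷ (f zero) later) (s≤s rest)
      first (no ¬last) =
        ≤-trans (length-deduplicate-catMaybes-∷-∈ (f zero) later (¬lastOccurrence⇒repeated f ¬last)) rest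

module _ {n} (G : EdgeColoredGraph n) where

  Represents : Fin n → Fin n → Set
  Represents v = LastOccurrence (col G v)

  represents? : Decidable₂ Represents
  represents? v = lastOccurrence? _≟_ (col G v)

  2*colorDegreeSum≤n²+∑degree :
    2 * colorDegreeSum G ≤ n * n + ∑[ v ∈ allFin n ] degree (mutual? represents?) (allFin n) v
  2*colorDegreeSum≤n²+∑degree = begin
    2 * colorDegreeSum G
      ≤⟨ *-monoʳ-≤ 2 (∑-mono-≤ (allFin n) (λ v → distinctValues≤lastOccurrences _≟_ (col G v))) ⟩
    2 * ∑[ v ∈ allFin n ] count (represents? v) (allFin n)
      ≤⟨ 2*∑count≤length²+∑count-mutual represents? (allFin n) ⟩
    length (allFin n) * length (allFin n) + mutualDegrees
      ≡⟨ cong (λ m → m * m + mutualDegrees) (length-tabulate {n = n} id) ⟩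
    n * n + mutualDegrees ∎
    where
      open ≤-Reasoning
      mutualDegrees = ∑[ v ∈ allFin n ] degree (mutual? represents?) (allFin n) v

  biclique⇒properKst : ∀ {s t} → Biclique (mutual? represents?) s t (allFin n) (allFin n) → ProperKst G s t
  biclique⇒properKst b = record
    { f = f
    ; g = g
    ; f-inj = f-inj
    ; g-inj = g-inj
    ; disjoint = λ i j fi≡gj → irreflexive (subst (Represents (g j)) fi≡gj (proj₁ (adjacent i j)))
    ; isEdge = λ i j → proj₁ (proj₂ (adjacent i j))
    ; properAtF = λ i j j′ j≢j′ sameColour →
        j≢j′ (g-inj (lastOccurrence-injective (proj₂ (adjacent i j)) (proj₂ (adjacent i j′)) sameColour))
    ; properAtG = λ i i′ j i≢i′ sameColour →
        i≢i′ (f-inj (lastOccurrence-injective (proj₁ (adjacent i j)) (proj₁ (adjacent i′ j))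
          (trans (symm G (g j) (f i)) (trans sameColour (symm G (f i′) (g j))))))
    }
    where
      open Biclique b
      s≤|core| = ≤-reflexive (sym |core|≡s)
      f = embed core s≤|core|
      g = embed commonNeighbours t≤|commonNeighbours|
      f-inj = embed-injective s≤|core| (Unique-resp-⊆ core⊆ (allFin⁺ n))
      g-inj = embed-injective t≤|commonNeighbours| (Unique-resp-⊆ commonNeighbours⊆ (allFin⁺ n))
      adjacent : ∀ i j → Represents (g j) (f i) × Represents (f i) (g j)
      adjacent i j = All.lookup (All.lookup complete (∈-lookup _)) (∈-lookup _)
      irreflexive : ∀ {v} → ¬ Represents v v
      irreflexive {v} (isEdge , _) = isEdge (loopless G v)

excess≤∑[∸k] : ∀ {S : ℕ} (V : List A) (d : A → ℕ) k → let n = length V in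
  2 * S ≤ n * n + ∑[ v ∈ V ] d v → 2 * S ∸ (n * n + 2 * suc k * n) ≤ ∑[ v ∈ V ] (d v ∸ k)
excess≤∑[∸k] {S = S} V d k 2S≤n²+∑d = m≤n+o⇒m∸n≤o (2 * S) (n * n + 2 * s * n) (begin
  2 * S                   ≤⟨ 2S≤n²+∑d ⟩
  n * n + ∑[ v ∈ V ] d v  ≤⟨ +-monoʳ-≤ (n * n) (∑≤length*k+∑[∸k] V d k) ⟩
  n * n + (n * k + X)     ≤⟨ +-monoʳ-≤ (n * n) (+-monoˡ-≤ X nk≤2sn) ⟩
  n * n + (2 * s * n + X) ≡⟨ +-assoc (n * n) _ X ⟨
  n * n + 2 * s * n + X ∎)
  where
    open ≤-Reasoning
    n = length V
    s = suc k
    X = ∑[ v ∈ V ] (d v ∸ k)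
    nk≤2sn : n * k ≤ 2 * s * n
    nk≤2sn = ≤-trans (*-monoʳ-≤ n (≤-trans (n≤1+n k) (m≤m+n s (s + 0)))) (≤-reflexive (*-comm n (2 * s)))

threshold⇒manyStars : ∀ {n k t S} (V : List A) (d : A → ℕ) → length V ≡ n →
  2 * S ≤ n * n + ∑[ v ∈ V ] d v → Threshold n (suc k) t S →
  (t ∸ 1) * (length V C suc k) < ∑[ v ∈ V ] (d v C suc k)
threshold⇒manyStars {k = k} {t} {S} V d refl 2S≤n²+∑d (_ , threshold) =
  ≰⇒> λ fewStars → <⇒≱ threshold (begin
    k ! * (2 * S ∸ (n * n + 2 * s * n)) ^ s
      ≤⟨ *-monoʳ-≤ (k !) (^-monoˡ-≤ s (excess≤∑[∸k] {S = S} V d k 2S≤n²+∑d)) ⟩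
    k ! * (∑[ v ∈ V ] (d v ∸ k)) ^ s
      ≤⟨ *-monoʳ-≤ (k !) (kovari-sos-turan V d k (t ∸ 1) n fewStars) ⟩
    k ! * ((t ∸ 1) * (n ^ k * n ^ s))
      ≤⟨ *-monoˡ-≤ _ k!≤2^s*s^s ⟩
    2 ^ s * s ^ s * ((t ∸ 1) * (n ^ k * n ^ s))
      ≡⟨ *-assoc (2 ^ s * s ^ s) (t ∸ 1) _ ⟨
    2 ^ s * s ^ s * (t ∸ 1) * (n ^ k * n ^ s)
      ≡⟨ cong (2 ^ s * s ^ s * (t ∸ 1) *_) n^k*n^s≡n^[2s∸1] ⟩
    2 ^ s * s ^ s * (t ∸ 1) * n ^ (2 * s ∸ 1) ∎)
  where
    open ≤-Reasoning
    n = length V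
    s = suc k
    k!≤2^s*s^s : k ! ≤ 2 ^ s * s ^ s
    k!≤2^s*s^s = ≤-trans (m≤n*m (k !) s) (≤-trans (n!≤n^n s) (m≤n*m (s ^ s) (2 ^ s) {{m^n≢0 2 s}}))
    n^k*n^s≡n^[2s∸1] : n ^ k * n ^ s ≡ n ^ (2 * s ∸ 1)
    n^k*n^s≡n^[2s∸1] = trans (sym (^-distribˡ-+-* n k s)) (cong (λ e → n ^ (k + e)) (sym (+-identityʳ s)))

theorem4p2 : (n s t : ℕ) → 2 ≤ s → s ≤ t → t ≤ n →
    (G : EdgeColoredGraph n) →
    Threshold n s t (colorDegreeSum G) →
    ProperKst G s t
theorem4p2 n (suc k) t _ _ _ G threshold =
  biclique⇒properKst G (biclique-from-stars H t (suc k) (allFin n) (allFin n) manyStars)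
  where
    H = mutual? (represents? G)
    manyStars = threshold⇒manyStars {t = t} {S = colorDegreeSum G} (allFin n) (degree H (allFin n))
                  (length-tabulate id) (2*colorDegreeSum≤n²+∑degree G) threshold
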